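{- Let $m\ge1$ and let $(T_1,T_2)$ be a $2$-tiling of the Aztec diamond of rank $m$ with no interactions. Then for each $i$, the $i$-th path of $T_1$ lies weakly below the $i$-th path of $T_2$ and strictly above the $(i+1)$-th path of $T_2$ (at every abscissa where both paths in question are defined).
   Context: The Aztec diamond of rank $m$ is the union of the closed unit squares $[a,a+1]\times[b,b+1]$ ($a,b\in\mathbb Z$) contained in $\{|x|+|y|\le m+1\}$; a square is gray if $a+b+m$ is even and white otherwise. A $2$-tiling is a pair $(T_1,T_2)$ of domino tilings of it. Interactions: for a tiling $T$ and a gray square $g$, let $d_T(g)\in\{N,E,S,W\}$ be the direction from $g$ to the white square covered together with $g$ by a domino of $T$; $g$ is an interaction of $(T_1,T_2)$ if $(d_{T_1}(g),d_{T_2}(g))\in\{(N,W),(S,S),(W,S),(N,S)\}$. Paths: to each domino of a tiling $T$ associate a segment: for a vertical domino with gray lower square, the segment from the midpoint of the left side of its upper square to the midpoint of the right side of its lower square (a step $(1,-1)$); for a vertical domino with white lower square, the segment from the midpoint of the left side of its lower square to the midpoint of the right side of its upper square (a step $(1,1)$); for a horizontal domino whose right square is gray, the segment joining the midpoints of its left and right sides (a step $(2,0)$); a horizontal domino whose left square is gray gets no segment. The union of these segments is a family of $m$ non-intersecting paths, the $i$-th path going from $(-m-1+i,-i+\frac12)$ to $(m+1-i,-i+\frac12)$.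
   Formalization: The paths are compared only at rational abscissas, with the heights of their points on both paths also taken to be rational. -}

module Defs where

open import Data.Nat as ℕ using (ℕ; suc)
open import Data.Nat.Divisibility as ℕD using ()
open import Data.Integer as ℤ using (ℤ; +_; ∣_∣)
open import Data.Rational as ℚ using (ℚ; ½)
open import Data.Product using (_×_; _,_)
open import Relation.Binary.PropositionalEquality using (_≡_)
open import Relation.Nullary using (¬_)

-- A unit square [a,a+1]×[b,b+1] is represented by its lower-left corner (a , b).
Sq : Set
Sq = ℤ × ℤ

InBall : ℕ → ℤ → ℤ → Set
InBall m x y = ∣ x ∣ ℕ.+ ∣ y ∣ ℕ.≤ suc m

-- The square is contained in {|x|+|y| ≤ m+1} (the region is convex, so this
-- is the same as all four corners lying in it).
InAztec : ℕ → Sq → Set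
InAztec m (a , b) =
  InBall m a b × InBall m (a ℤ.+ ℤ.1ℤ) b ×
  InBall m a (b ℤ.+ ℤ.1ℤ) × InBall m (a ℤ.+ ℤ.1ℤ) (b ℤ.+ ℤ.1ℤ)

Gray : ℕ → Sq → Set
Gray m (a , b) = 2 ℕD.∣ ∣ a ℤ.+ b ℤ.+ + m ∣

data Dir : Set where
  N E S W : Dir

opp : Dir → Dir
opp N = S
opp S = N
opp E = W
opp W = E

move : Dir → Sq → Sq
move N (a , b) = a , b ℤ.+ ℤ.1ℤ
move S (a , b) = a , b ℤ.- ℤ.1ℤ
move E (a , b) = a ℤ.+ ℤ.1ℤ , b
move W (a , b) = a ℤ.- ℤ.1ℤ , b

-- A domino tiling of the Aztec diamond of rank m, given as a perfect matching
-- of adjacent squares: every square s of the region is covered, together with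
-- the adjacent square  move (dir s) s  (also in the region), by one domino;
-- and the partner's partner is s itself.  Values of dir outside the region
-- are irrelevant.
record Tiling (m : ℕ) : Set where
  field
    dir     : Sq → Dir
    partner-in : ∀ s → InAztec m s → InAztec m (move (dir s) s)
    partner-inv : ∀ s → InAztec m s → dir (move (dir s) s) ≡ opp (dir s)
open Tiling public

d : ∀ {m} → Tiling m → Sq → Dir
d T g = dir T g

data InteractionPair : Dir → Dir → Set where
  NW : InteractionPair N W
  SS : InteractionPair S S
  WS : InteractionPair W S
  NS : InteractionPair N S

IsInteraction : ∀ m → Tiling m → Tiling m → Sq → Set
IsInteraction m T₁ T₂ g = InAztec m g × Gray m g × InteractionPair (d T₁ g) (d T₂ g)

NoInteractions : ∀ m → Tiling m → Tiling m → Set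
NoInteractions m T₁ T₂ = ∀ g → ¬ IsInteraction m T₁ T₂ g

-- Path points: a pair (x , k) of integers stands for the point (x , k + 1/2).
Pt : Set
Pt = ℤ × ℤ

-- The segments associated with the dominoes of T (indexed by the gray square
-- (a , b) of the domino and its direction d_T).
data Seg (m : ℕ) (T : Tiling m) : Pt → Pt → Set where
  -- vertical domino, gray lower square: from left side of upper square to
  -- right side of lower square
  segN : ∀ a b → InAztec m (a , b) → Gray m (a , b) → d T (a , b) ≡ N →
         Seg m T (a , b ℤ.+ ℤ.1ℤ) (a ℤ.+ ℤ.1ℤ , b)
  -- vertical domino, white lower square: from left side of lower square to
  -- right side of upper square
  segS : ∀ a b → InAztec m (a , b) → Gray m (a , b) → d T (a , b) ≡ S →
         Seg m T (a , b ℤ.- ℤ.1ℤ) (a ℤ.+ ℤ.1ℤ , b)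
  -- horizontal domino with gray right square: left side to right side
  segW : ∀ a b → InAztec m (a , b) → Gray m (a , b) → d T (a , b) ≡ W →
         Seg m T (a ℤ.- ℤ.1ℤ , b) (a ℤ.+ ℤ.1ℤ , b)

data SegPath (m : ℕ) (T : Tiling m) : Pt → Pt → Set where
  stop : ∀ {p} → SegPath m T p p
  step : ∀ {p q r} → Seg m T p q → SegPath m T q r → SegPath m T p r

xℚ : Pt → ℚ
xℚ (x , k) = x ℚ./ 1

yℚ : Pt → ℚ
yℚ (x , k) = (k ℚ./ 1) ℚ.+ ½

OnSegment : Pt → Pt → ℚ → ℚ → Set
OnSegment p q t h =
  xℚ p ℚ.≤ t × t ℚ.≤ xℚ q ×
  (h ℚ.- yℚ p) ℚ.* (xℚ q ℚ.- xℚ p) ≡ (t ℚ.- xℚ p) ℚ.* (yℚ q ℚ.- yℚ p)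

data OnPath {m : ℕ} {T : Tiling m} (t h : ℚ) : ∀ {p r} → SegPath m T p r → Set where
  here  : ∀ {p q r} {s : Seg m T p q} {P : SegPath m T q r} →
          OnSegment p q t h → OnPath t h (step s P)
  there : ∀ {p q r} {s : Seg m T p q} {P : SegPath m T q r} →
          OnPath t h P → OnPath t h (step s P)

start : ℕ → ℕ → Pt
start m i = (+ i ℤ.- + m ℤ.- ℤ.1ℤ) , ℤ.- (+ i)

end : ℕ → ℕ → Pt
end m i = (+ m ℤ.+ ℤ.1ℤ ℤ.- + i) , ℤ.- (+ i)

Path : (m : ℕ) → Tiling m → ℕ → Set
Path m T i = SegPath m T (start m i) (end m i)

{-# OPTIONS --safe #-}
-- Cut every path into unit steps between consecutive integer abscissae.  If at
-- some abscissa a path of T₂ lies strictly below a path of T₁ and one step later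
-- weakly above it, then the gray squares of the two dominoes carrying these steps
-- either coincide, giving an interaction, or are adjacent, which parity forbids.
-- So "strictly below" propagates forwards.  The i-th paths of T₁ and T₂ share
-- their end point, hence the one of T₂ is never strictly below; the (i+1)-th path
-- of T₂ starts strictly below the first vertex of the i-th path of T₁ after its
-- start (a path cannot begin by descending: that domino would leave the diamond),
-- hence it stays strictly below.  Paths are linear between integer abscissae.
module Submission where

open import Defs
open import Data.Nat using (ℕ; suc; _≤_; _<_)
open import Data.Rational as ℚ using (ℚ)
open import Data.Product using (_×_)

import Data.Nat as ℕ
import Data.Nat.Properties as ℕP
import Data.Nat.Divisibility as ℕD
import Data.Nat.Coprimality as ℕC
open import Data.Integer as ℤ using (ℤ; +_; ∣_∣; 0ℤ; 1ℤ; +<+)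
import Data.Integer.Properties as ℤP
import Data.Integer.Divisibility as ℤD
import Data.Integer.Divisibility.Signed as ℤDˢ
open import Data.Integer.Tactic.RingSolver using (solve-∀)
open import Data.Rational using (mkℚ; 0ℚ; 1ℚ; ½; *≤*; _+_; _*_; _-_)
import Data.Rational.Properties as ℚP
open import Data.Rational.Solver using (module +-*-Solver)
open import Data.Product using (Σ; _,_)
open import Data.Product.Properties using (,-injectiveˡ; ,-injectiveʳ)
open import Data.Sum using (_⊎_; inj₁; inj₂)
open import Data.Empty using (⊥; ⊥-elim)
open import Relation.Nullary using (¬_; yes; no)
open import Relation.Binary using (tri<; tri≈; tri>)
open import Relation.Binary.PropositionalEquality

<⇒+1≤ : ∀ {i j} → i ℤ.< j → i ℤ.+ 1ℤ ℤ.≤ j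
<⇒+1≤ {i} i<j = subst (ℤ._≤ _) (ℤP.+-comm 1ℤ i) (ℤP.i<j⇒suc[i]≤j i<j)

+1≤⇒< : ∀ {i j} → i ℤ.+ 1ℤ ℤ.≤ j → i ℤ.< j
+1≤⇒< {i} i+1≤j = ℤP.suc[i]≤j⇒i<j (subst (ℤ._≤ _) (ℤP.+-comm i 1ℤ) i+1≤j)

<+1⇒≤ : ∀ {i j} → i ℤ.< j ℤ.+ 1ℤ → i ℤ.≤ j
<+1⇒≤ i<j+1 = ℤP.≮⇒≥ (λ j<i → ℤP.<-irrefl refl (ℤP.<-≤-trans i<j+1 (<⇒+1≤ j<i)))

i≡i-1+1 : ∀ i → i ≡ i ℤ.- 1ℤ ℤ.+ 1ℤ
i≡i-1+1 = solve-∀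

i≤i+1 : ∀ i → i ℤ.≤ i ℤ.+ 1ℤ
i≤i+1 i = ℤP.i≤i+j i 1ℤ

i+1≰i : ∀ i → ¬ (i ℤ.+ 1ℤ ℤ.≤ i)
i+1≰i i i+1≤i = ℤP.<-irrefl refl (+1≤⇒< i+1≤i)

≤≤+1⇒≡⊎≡+1 : ∀ {i j} → i ℤ.≤ j → j ℤ.≤ i ℤ.+ 1ℤ → j ≡ i ⊎ j ≡ i ℤ.+ 1ℤ
≤≤+1⇒≡⊎≡+1 {i} {j} i≤j j≤i+1 with ℤP.<-cmp i j
... | tri< i<j _ _ = inj₂ (ℤP.≤-antisym j≤i+1 (<⇒+1≤ i<j))
... | tri≈ _ i≡j _ = inj₁ (sym i≡j)
... | tri> _ _ j<i = ⊥-elim (ℤP.≤⇒≯ i≤j j<i)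

even∧even+1⇒⊥ : ∀ x → + 2 ℤD.∣ x → + 2 ℤD.∣ x ℤ.+ 1ℤ → ⊥
even∧even+1⇒⊥ x 2∣x 2∣x+1 with ℕD.∣1⇒≡1 (ℤDˢ.∣⇒∣ᵤ {+ 2} {1ℤ} 2∣1)
  where
  2∣1 : + 2 ℤDˢ.∣ 1ℤ
  2∣1 = ℤDˢ.∣m+n∣m⇒∣n {m = x} (ℤDˢ.∣ᵤ⇒∣ {i = x ℤ.+ 1ℤ} 2∣x+1) (ℤDˢ.∣ᵤ⇒∣ {i = x} 2∣x)
... | ()

-- Paths as walks of unit steps

record Domino {m} (T : Tiling m) (s : Sq) (D : Dir) : Set where
  constructor domino
  field
    inside : InAztec m s
    gray   : Gray m s
    points : d T s ≡ D
open Domino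

gray-above : ∀ {m a b b′ D D′} {T T′ : Tiling m} →
             b′ ≡ b ℤ.+ 1ℤ → Domino T (a , b) D → ¬ Domino T′ (a , b′) D′
gray-above {m} {a} {b} refl g g′ =
  even∧even+1⇒⊥ (a ℤ.+ b ℤ.+ + m) (gray g) (subst (+ 2 ℤD.∣_) (shift a b (+ m)) (gray g′))
  where
  shift : ∀ a b m → a ℤ.+ (b ℤ.+ 1ℤ) ℤ.+ m ≡ a ℤ.+ b ℤ.+ m ℤ.+ 1ℤ
  shift = solve-∀

gray-right : ∀ {m a b b′ D D′} {T T′ : Tiling m} →
             b ≡ b′ → Domino T (a , b) D → ¬ Domino T′ (a ℤ.+ 1ℤ , b′) D′
gray-right {m} {a} {b} refl g g′ =
  even∧even+1⇒⊥ (a ℤ.+ b ℤ.+ + m) (gray g) (subst (+ 2 ℤD.∣_) (shift a b (+ m)) (gray g′))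
  where
  shift : ∀ a b m → a ℤ.+ 1ℤ ℤ.+ b ℤ.+ m ≡ a ℤ.+ b ℤ.+ m ℤ.+ 1ℤ
  shift = solve-∀

-- Step T c k k′ goes from (c , k) to (c + 1 , k′); the gray square of its domino
-- lies in row k′ (in column c + 1 for the left half of a horizontal domino).
data Step {m} (T : Tiling m) (c : ℤ) : ℤ → ℤ → Set where
  up    : ∀ {k} → Domino T (c , k ℤ.+ 1ℤ) S → Step T c k (k ℤ.+ 1ℤ)
  down  : ∀ {k} → Domino T (c , k) N → Step T c (k ℤ.+ 1ℤ) k
  flatˡ : ∀ {k} → Domino T (c ℤ.+ 1ℤ , k) W → Step T c k k
  flatʳ : ∀ {k} → Domino T (c , k) W → Step T c k k

infixr 5 _∷_

data Walk {m} (T : Tiling m) : Pt → Pt → Set where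
  []  : ∀ {p} → Walk T p p
  _∷_ : ∀ {c k k′ q} → Step T c k k′ → Walk T (c ℤ.+ 1ℤ , k′) q → Walk T (c , k) q

Through : ∀ {m} → Tiling m → Pt → Pt → Pt → Set
Through T s e p = Walk T s p × Walk T p e

module _ {m} {T : Tiling m} where

  infixr 5 _++_

  _++_ : ∀ {p q r} → Walk T p q → Walk T q r → Walk T p r
  []      ++ w′ = w′
  (s ∷ w) ++ w′ = s ∷ (w ++ w′)

  walk-column-≤ : ∀ {c k c′ k′} → Walk T (c , k) (c′ , k′) → c ℤ.≤ c′
  walk-column-≤ []      = ℤP.≤-refl
  walk-column-≤ (_ ∷ w) = ℤP.≤-trans (i≤i+1 _) (walk-column-≤ w)

  step-rise-≤1 : ∀ {c k k′} → Step T c k k′ → k′ ℤ.≤ k ℤ.+ 1ℤ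
  step-rise-≤1 (up _)    = ℤP.≤-refl
  step-rise-≤1 (down _)  = ℤP.≤-trans (i≤i+1 _) (i≤i+1 _)
  step-rise-≤1 (flatˡ _) = i≤i+1 _
  step-rise-≤1 (flatʳ _) = i≤i+1 _

  step-fall-≤1 : ∀ {c k k′} → Step T c k k′ → k ℤ.≤ k′ ℤ.+ 1ℤ
  step-fall-≤1 (up _)    = ℤP.≤-trans (i≤i+1 _) (i≤i+1 _)
  step-fall-≤1 (down _)  = ℤP.≤-refl
  step-fall-≤1 (flatˡ _) = i≤i+1 _
  step-fall-≤1 (flatʳ _) = i≤i+1 _

  up-to : ∀ {c j k} → k ≡ j ℤ.+ 1ℤ → Domino T (c , k) S → Step T c j k
  up-to refl g = up g

  flat-pair : ∀ {a b c} → a ≡ c ℤ.+ 1ℤ → Domino T (a , b) W → Walk T (c , b) (a ℤ.+ 1ℤ , b)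
  flat-pair refl g = flatˡ g ∷ flatʳ g ∷ []

  seg⇒walk : ∀ {p q} → Seg m T p q → Walk T p q
  seg⇒walk (segN a b ins gr pts) = down (domino ins gr pts) ∷ []
  seg⇒walk (segS a b ins gr pts) = up-to (i≡i-1+1 b) (domino ins gr pts) ∷ []
  seg⇒walk (segW a b ins gr pts) = flat-pair (i≡i-1+1 a) (domino ins gr pts)

  path⇒walk : ∀ {p q} → SegPath m T p q → Walk T p q
  path⇒walk stop       = []
  path⇒walk (step σ P) = seg⇒walk σ ++ path⇒walk P

-- Non-crossing

module _ {m} {T₁ T₂ : Tiling m} (no-interaction : NoInteractions m T₁ T₂) where

  same-square : ∀ {c k k′ D₁ D₂} → k ≡ k′ →
                Domino T₁ (c , k) D₁ → Domino T₂ (c , k′) D₂ → ¬ InteractionPair D₁ D₂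
  same-square refl (domino i g refl) (domino _ _ refl) pair = no-interaction _ (i , g , pair)

  steps-cannot-cross : ∀ {c p p′ q q′} → Step T₁ c p p′ → Step T₂ c q q′ →
                       q ℤ.< p → ¬ (p′ ℤ.≤ q′)
  steps-cannot-cross (up _) sq q<p p′≤q′ =
    ℤP.<-irrefl refl (ℤP.≤-<-trans (ℤP.≤-trans p′≤q′ (step-rise-≤1 sq)) (ℤP.+-monoˡ-< 1ℤ q<p))
  steps-cannot-cross sp (down _) q<p p′≤q′ =
    ℤP.<-irrefl refl (ℤP.<-≤-trans q<p (ℤP.≤-trans (step-fall-≤1 sp) (ℤP.+-monoˡ-≤ 1ℤ p′≤q′)))
  steps-cannot-cross (flatˡ _) (flatˡ _) q<p p≤q = ℤP.≤⇒≯ p≤q q<p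
  steps-cannot-cross (flatˡ _) (flatʳ _) q<p p≤q = ℤP.≤⇒≯ p≤q q<p
  steps-cannot-cross (flatʳ _) (flatˡ _) q<p p≤q = ℤP.≤⇒≯ p≤q q<p
  steps-cannot-cross (flatʳ _) (flatʳ _) q<p p≤q = ℤP.≤⇒≯ p≤q q<p
  steps-cannot-cross (down g₁) (flatʳ g₂) q<p p′≤q =
    same-square (ℤP.≤-antisym p′≤q (<+1⇒≤ q<p)) g₁ g₂ NW
  steps-cannot-cross (down g₁) (flatˡ g₂) q<p p′≤q =
    gray-right (ℤP.≤-antisym p′≤q (<+1⇒≤ q<p)) g₁ g₂
  steps-cannot-cross (flatʳ g₁) (up g₂) q<p p≤q+1 =
    same-square (ℤP.≤-antisym p≤q+1 (<⇒+1≤ q<p)) g₁ g₂ WS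
  steps-cannot-cross (flatˡ g₁) (up g₂) q<p p≤q+1 =
    gray-right (ℤP.≤-antisym (<⇒+1≤ q<p) p≤q+1) g₂ g₁
  steps-cannot-cross (down g₁) (up g₂) q<p′+1 p′≤q+1
    with ≤≤+1⇒≡⊎≡+1 (<+1⇒≤ q<p′+1) p′≤q+1
  ... | inj₁ p′≡q   = gray-above (cong (ℤ._+ 1ℤ) (sym p′≡q)) g₁ g₂
  ... | inj₂ p′≡q+1 = same-square p′≡q+1 g₁ g₂ NS

  stays-below : ∀ {c p q c′ p′ q′} → Walk T₁ (c , p) (c′ , p′) → Walk T₂ (c , q) (c′ , q′) →
                q ℤ.< p → q′ ℤ.< p′
  stays-below [] []      q<p = q<p
  stays-below [] (_ ∷ w) _   = ⊥-elim (i+1≰i _ (walk-column-≤ w))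
  stays-below (_ ∷ w) [] _   = ⊥-elim (i+1≰i _ (walk-column-≤ w))
  stays-below (_∷_ {k′ = p₁} sp wp) (_∷_ {k′ = q₁} sq wq) q<p with q₁ ℤP.<? p₁
  ... | yes q₁<p₁ = stays-below wp wq q₁<p₁
  ... | no  q₁≮p₁ = ⊥-elim (steps-cannot-cross sp sq q<p (ℤP.≮⇒≥ q₁≮p₁))

  shifted-start-stays-below : ∀ {a b a′ b′ c p q} → (∀ {k′} → Step T₁ a b k′ → b ℤ.≤ k′) →
                          Walk T₁ (a , b) (c , p) → Walk T₂ (a′ , b′) (c , q) →
                          a′ ≡ a ℤ.+ 1ℤ → b′ ℤ.< b → q ℤ.< p
  shifted-start-stays-below _ [] w refl _ = ⊥-elim (i+1≰i _ (walk-column-≤ w))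
  shifted-start-stays-below never-descends (s ∷ w₁) w₂ refl b′<b =
    stays-below w₁ w₂ (ℤP.<-≤-trans b′<b (never-descends s))

below-start-outside : ∀ {m i a k} → (a , k ℤ.+ 1ℤ) ≡ start m i → ¬ InAztec m (a , k)
below-start-outside {m} {i} {a} {k} at-start (corner , _) =
  ℕP.<-irrefl refl (ℕP.≤-trans far corner)
  where
  a≡ : a ≡ + i ℤ.- + m ℤ.- 1ℤ
  a≡ = ,-injectiveˡ at-start
  k+1≡ : k ℤ.+ 1ℤ ≡ ℤ.- + i
  k+1≡ = ,-injectiveʳ at-start
  shift : ∀ a k → a ℤ.+ k ≡ a ℤ.+ (k ℤ.+ 1ℤ ℤ.- 1ℤ)
  shift = solve-∀
  collapse : ∀ i m → (i ℤ.- m ℤ.- 1ℤ) ℤ.+ (ℤ.- i ℤ.- 1ℤ) ≡ ℤ.- (+ 2 ℤ.+ m)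
  collapse = solve-∀
  a+k≡ : a ℤ.+ k ≡ ℤ.- (+ 2 ℤ.+ + m)
  a+k≡ = trans (shift a k)
           (trans (cong₂ (λ x y → x ℤ.+ (y ℤ.- 1ℤ)) a≡ k+1≡) (collapse (+ i) (+ m)))
  far : suc (suc m) ≤ ∣ a ∣ ℕ.+ ∣ k ∣
  far = subst (ℕ._≤ ∣ a ∣ ℕ.+ ∣ k ∣) (cong ∣_∣ a+k≡) (ℤP.∣i+j∣≤∣i∣+∣j∣ a k)

first-step-never-descends : ∀ {m i a b k′} {T : Tiling m} →
                            (a , b) ≡ start m i → Step T a b k′ → b ℤ.≤ k′
first-step-never-descends _        (up _)       = i≤i+1 _
first-step-never-descends at-start (down {k} g) = ⊥-elim (below-start-outside {k = k} at-start (inside g))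
first-step-never-descends _        (flatˡ _)    = ℤP.≤-refl
first-step-never-descends _        (flatʳ _)    = ℤP.≤-refl

-- Heights between integer abscissae

ι : ℤ → ℚ
ι x = x ℚ./ 1

ι≡mkℚ : ∀ x → ι x ≡ mkℚ x 0 (ℕC.sym (ℕC.1-coprimeTo ∣ x ∣))
ι≡mkℚ (+ n)      = ℚP.normalize-coprime (ℕC.sym (ℕC.1-coprimeTo n))
ι≡mkℚ ℤ.-[1+ n ] = cong ℚ.-_ (ℚP.normalize-coprime (ℕC.sym (ℕC.1-coprimeTo (suc n))))

ι-+ : ∀ x y → ι (x ℤ.+ y) ≡ ι x + ι y
ι-+ x y = begin
  ι (x ℤ.+ y)                   ≡⟨ cong ι (cong₂ ℤ._+_ (sym (ℤP.*-identityʳ x)) (sym (ℤP.*-identityʳ y))) ⟩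
  ι (x ℤ.* + 1 ℤ.+ y ℤ.* + 1)   ≡⟨ cong₂ _+_ (ι≡mkℚ x) (ι≡mkℚ y) ⟨
  ι x + ι y                     ∎
  where open ≡-Reasoning

ι-mono-≤ : ∀ {x y} → x ℤ.≤ y → ι x ℚ.≤ ι y
ι-mono-≤ {x} {y} x≤y rewrite ι≡mkℚ x | ι≡mkℚ y =
  *≤* (subst₂ ℤ._≤_ (sym (ℤP.*-identityʳ x)) (sym (ℤP.*-identityʳ y)) x≤y)

ι-cancel-≤ : ∀ {x y} → ι x ℚ.≤ ι y → x ℤ.≤ y
ι-cancel-≤ {x} {y} ιx≤ιy rewrite ι≡mkℚ x | ι≡mkℚ y with ιx≤ιy
... | *≤* x*1≤y*1 = subst₂ ℤ._≤_ (ℤP.*-identityʳ x) (ℤP.*-identityʳ y) x*1≤y*1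

lerp : ℚ → ℚ → ℚ → ℚ
lerp y y′ s = y * (1ℚ - s) + y′ * s

module _ where
  open +-*-Solver

  lerp-0 : ∀ y y′ → lerp y y′ 0ℚ ≡ y
  lerp-0 = solve 2 (λ y y′ → y :* (con 1ℚ :- con 0ℚ) :+ y′ :* con 0ℚ := y) refl

  lerp-1 : ∀ y y′ → lerp y y′ 1ℚ ≡ y′
  lerp-1 = solve 2 (λ y y′ → y :* (con 1ℚ :- con 1ℚ) :+ y′ :* con 1ℚ := y′) refl

  lerp-const : ∀ y s → lerp y y s ≡ y
  lerp-const = solve 2 (λ y s → y :* (con 1ℚ :- s) :+ y :* s := y) refl

  lerp-+ : ∀ y y′ s δ → lerp y y′ s + δ ≡ lerp (y + δ) (y′ + δ) s
  lerp-+ = solve 4 (λ y y′ s δ → y :* (con 1ℚ :- s) :+ y′ :* s :+ δ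
                               := (y :+ δ) :* (con 1ℚ :- s) :+ (y′ :+ δ) :* s) refl

  x+1-x≡1 : ∀ x → (x + 1ℚ) - x ≡ 1ℚ
  x+1-x≡1 = solve 1 (λ x → (x :+ con 1ℚ) :- x := con 1ℚ) refl

  chord-unit : ∀ {h t X X′ Y Y′} → X′ ≡ X + 1ℚ →
               (h - Y) * (X′ - X) ≡ (t - X) * (Y′ - Y) → h ≡ lerp Y Y′ (t - X)
  chord-unit {h} {t} {X} {_} {Y} {Y′} refl chord = begin
    h                                 ≡⟨ expand h X Y ⟩
    (h - Y) * ((X + 1ℚ) - X) + Y      ≡⟨ cong (_+ Y) chord ⟩
    (t - X) * (Y′ - Y) + Y            ≡⟨ collect t X Y Y′ ⟩
    lerp Y Y′ (t - X)                 ∎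
    where
    open ≡-Reasoning
    expand = solve 3 (λ h X Y → h := (h :- Y) :* ((X :+ con 1ℚ) :- X) :+ Y) refl
    collect = solve 4 (λ t X Y Y′ → (t :- X) :* (Y′ :- Y) :+ Y
                                  := Y :* (con 1ℚ :- (t :- X)) :+ Y′ :* (t :- X)) refl

  chord-flat : ∀ {h t X X′ Y} → X′ ≡ X + 1ℚ + 1ℚ →
               (h - Y) * (X′ - X) ≡ (t - X) * (Y - Y) → h ≡ Y
  chord-flat {h} {t} {X} {_} {Y} refl chord = begin
    h                                        ≡⟨ expand h X Y ⟩
    (h - Y) * ((X + 1ℚ + 1ℚ) - X) * ½ + Y    ≡⟨ cong (λ z → z * ½ + Y) chord ⟩
    (t - X) * (Y - Y) * ½ + Y                ≡⟨ collapse t X Y ⟩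
    Y                                        ∎
    where
    open ≡-Reasoning
    expand = solve 3 (λ h X Y → h := (h :- Y) :* ((X :+ con 1ℚ :+ con 1ℚ) :- X) :* con ½ :+ Y) refl
    collapse = solve 3 (λ t X Y → (t :- X) :* (Y :- Y) :* con ½ :+ Y := Y) refl

  level-+ : ∀ k d → ι k + ½ + ι d ≡ ι (k ℤ.+ d) + ½
  level-+ k d = trans (shuffle (ι k) (ι d)) (cong (_+ ½) (sym (ι-+ k d)))
    where shuffle = solve 2 (λ a b → a :+ con ½ :+ b := a :+ b :+ con ½) refl

≤⇒0≤- : ∀ {p q} → p ℚ.≤ q → 0ℚ ℚ.≤ q - p
≤⇒0≤- {p} {q} p≤q = subst (ℚ._≤ q - p) (ℚP.+-inverseʳ p) (ℚP.+-monoˡ-≤ (ℚ.- p) p≤q)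

lerp-mono-≤ : ∀ {y y′ z z′ s} → 0ℚ ℚ.≤ s → s ℚ.≤ 1ℚ → y ℚ.≤ z → y′ ℚ.≤ z′ →
              lerp y y′ s ℚ.≤ lerp z z′ s
lerp-mono-≤ {s = s} 0≤s s≤1 y≤z y′≤z′ =
  ℚP.+-mono-≤ (ℚP.*-monoʳ-≤-nonNeg (1ℚ - s) {{ℚ.nonNegative (≤⇒0≤- s≤1)}} y≤z)
              (ℚP.*-monoʳ-≤-nonNeg s {{ℚ.nonNegative 0≤s}} y′≤z′)

level-mono : ∀ k d {k′} → k ℤ.+ d ℤ.≤ k′ → ι k + ½ + ι d ℚ.≤ ι k′ + ½
level-mono k d {k′} k+d≤k′ =
  subst (ℚ._≤ ι k′ + ½) (sym (level-+ k d)) (ℚP.+-monoˡ-≤ ½ (ι-mono-≤ k+d≤k′))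

record StepAt {m} (T : Tiling m) (s e : Pt) (t h : ℚ) : Set where
  constructor stepAt
  field
    c k k′ : ℤ
    before : Walk T s (c , k)
    stepₜ  : Step T c k k′
    after  : Walk T (c ℤ.+ 1ℤ , k′) e
    lower  : ι c ℚ.≤ t
    upper  : t ℚ.≤ ι (c ℤ.+ 1ℤ)
    height : h ≡ lerp (ι k + ½) (ι k′ + ½) (t - ι c)

  through-left : Through T s e (c , k)
  through-left = before , stepₜ ∷ after

  through-right : Through T s e (c ℤ.+ 1ℤ , k′)
  through-right = before ++ stepₜ ∷ [] , after

  weight-≤1 : t - ι c ℚ.≤ 1ℚ
  weight-≤1 = subst (t - ι c ℚ.≤_) (x+1-x≡1 (ι c))
                (ℚP.+-monoˡ-≤ (ℚ.- ι c) (subst (t ℚ.≤_) (ι-+ c 1ℤ) upper))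

open StepAt using (through-left; through-right)

module _ {m} {T : Tiling m} {s e : Pt} {t h : ℚ} where

  unit-stepAt : ∀ {c k k′} → Walk T s (c , k) → Step T c k k′ → Walk T (c ℤ.+ 1ℤ , k′) e →
                OnSegment (c , k) (c ℤ.+ 1ℤ , k′) t h → StepAt T s e t h
  unit-stepAt {c} {k} {k′} before st after (lower , upper , chord) =
    stepAt c k k′ before st after lower upper
      (chord-unit {h} {t} {ι c} {Y = ι k + ½} {ι k′ + ½} (ι-+ c 1ℤ) chord)

  flat-height : ∀ {b c} → OnSegment (c , b) (c ℤ.+ 1ℤ ℤ.+ 1ℤ , b) t h →
                ∀ w → h ≡ lerp (ι b + ½) (ι b + ½) w
  flat-height {b} {c} (_ , _ , chord) w =
    trans (chord-flat {h} {t} {ι c} {Y = ι b + ½}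
             (trans (ι-+ (c ℤ.+ 1ℤ) 1ℤ) (cong (_+ 1ℚ) (ι-+ c 1ℤ))) chord)
          (sym (lerp-const (ι b + ½) w))

  flat-stepAt : ∀ {a b c} → a ≡ c ℤ.+ 1ℤ → Domino T (a , b) W →
                Walk T s (c , b) → Walk T (a ℤ.+ 1ℤ , b) e →
                OnSegment (c , b) (a ℤ.+ 1ℤ , b) t h → StepAt T s e t h
  flat-stepAt {b = b} {c} refl g before after on@(lower , upper , _) with t ℚP.≤? ι (c ℤ.+ 1ℤ)
  ... | yes t≤mid = stepAt c b b before (flatˡ g) (flatʳ g ∷ after)
                      lower t≤mid (flat-height {b} {c} on (t - ι c))
  ... | no  t≰mid = stepAt (c ℤ.+ 1ℤ) b b (before ++ flatˡ g ∷ []) (flatʳ g) after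
                      (ℚP.<⇒≤ (ℚP.≰⇒> t≰mid)) upper (flat-height {b} {c} on (t - ι (c ℤ.+ 1ℤ)))

  seg-stepAt : ∀ {p q} → Walk T s p → Seg m T p q → Walk T q e → OnSegment p q t h → StepAt T s e t h
  seg-stepAt before (segN a b ins gr pts) after =
    unit-stepAt before (down (domino ins gr pts)) after
  seg-stepAt before (segS a b ins gr pts) after =
    unit-stepAt before (up-to {j = b ℤ.- 1ℤ} (i≡i-1+1 b) (domino ins gr pts)) after
  seg-stepAt before (segW a b ins gr pts) after =
    flat-stepAt {c = a ℤ.- 1ℤ} (i≡i-1+1 a) (domino ins gr pts) before after

  onPath⇒stepAt : ∀ {p} → Walk T s p → (P : SegPath m T p e) → OnPath t h P → StepAt T s e t h
  onPath⇒stepAt before (step σ P) (here on)  = seg-stepAt before σ (path⇒walk P) on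
  onPath⇒stepAt before (step σ P) (there on) = onPath⇒stepAt (before ++ seg⇒walk σ) P on

  stepAt-vertex : ∀ {c₀} → StepAt T s e t h → t ≡ ι c₀ →
                  Σ ℤ λ k → Through T s e (c₀ , k) × h ≡ ι k + ½
  stepAt-vertex {c₀} x@(stepAt c k k′ _ _ _ lower upper refl) refl
    with ≤≤+1⇒≡⊎≡+1 (ι-cancel-≤ {c} {c₀} lower) (ι-cancel-≤ {c₀} {c ℤ.+ 1ℤ} upper)
  ... | inj₁ refl = k , through-left x ,
        trans (cong (lerp Y Y′) (ℚP.+-inverseʳ (ι c))) (lerp-0 Y Y′)
    where Y = ι k + ½; Y′ = ι k′ + ½
  ... | inj₂ refl = k′ , through-right x ,
        trans (cong (lerp Y Y′) (trans (cong (_- ι c) (ι-+ c 1ℤ)) (x+1-x≡1 (ι c)))) (lerp-1 Y Y′)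
    where Y = ι k + ½; Y′ = ι k′ + ½

stepAt-meet : ∀ {m m′} {T : Tiling m} {T′ : Tiling m′} {s e s′ e′ t h h′}
              (x : StepAt T s e t h) (y : StepAt T′ s′ e′ t h′) →
              StepAt.c x ℤ.< StepAt.c y → t ≡ ι (StepAt.c y)
stepAt-meet x y cx<cy =
  ℚP.≤-antisym (ℚP.≤-trans (StepAt.upper x) (ι-mono-≤ (<⇒+1≤ cx<cy))) (StepAt.lower y)

module _ {m} {X Y : Tiling m} {sX eX sY eY : Pt} (d : ℤ)
         (ordered : ∀ {c kx ky} → Through X sX eX (c , kx) → Through Y sY eY (c , ky) →
                    kx ℤ.+ d ℤ.≤ ky) where

  vertex-ordered : ∀ {t hx hy} c → StepAt X sX eX t hx → StepAt Y sY eY t hy → t ≡ ι c →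
                   hx + ι d ℚ.≤ hy
  vertex-ordered c x y t≡c with stepAt-vertex {c₀ = c} x t≡c | stepAt-vertex {c₀ = c} y t≡c
  ... | kx , x-through , refl | _ , y-through , refl = level-mono kx d (ordered x-through y-through)

  same-column-ordered : ∀ {t hx hy} (x : StepAt X sX eX t hx) (y : StepAt Y sY eY t hy) →
                        StepAt.c x ≡ StepAt.c y → hx + ι d ℚ.≤ hy
  same-column-ordered {t} x@(stepAt c kx kx′ _ _ _ lower _ refl)
                          y@(stepAt _ ky ky′ _ _ _ _ _ refl) refl = begin
    lerp (ι kx + ½) (ι kx′ + ½) w + ι d         ≡⟨ lerp-+ (ι kx + ½) (ι kx′ + ½) w (ι d) ⟩
    lerp (ι kx + ½ + ι d) (ι kx′ + ½ + ι d) w   ≤⟨ lerp-mono-≤ (≤⇒0≤- lower) (StepAt.weight-≤1 x) left right ⟩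
    lerp (ι ky + ½) (ι ky′ + ½) w               ∎
    where
    open ℚP.≤-Reasoning
    w = t - ι c
    left = level-mono kx d (ordered (through-left x) (through-left y))
    right = level-mono kx′ d (ordered (through-right x) (through-right y))

  heights-ordered : ∀ {t hx hy} → StepAt X sX eX t hx → StepAt Y sY eY t hy → hx + ι d ℚ.≤ hy
  heights-ordered x y with ℤP.<-cmp (StepAt.c x) (StepAt.c y)
  ... | tri< cx<cy _ _ = vertex-ordered (StepAt.c y) x y (stepAt-meet x y cx<cy)
  ... | tri≈ _ cx≡cy _ = same-column-ordered x y cx≡cy
  ... | tri> _ _ cy<cx = vertex-ordered (StepAt.c x) x y (stepAt-meet y x cy<cx)

start-suc-column : ∀ m i → + suc i ℤ.- + m ℤ.- 1ℤ ≡ + i ℤ.- + m ℤ.- 1ℤ ℤ.+ 1ℤ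
start-suc-column m i = trans (cong (λ x → x ℤ.- + m ℤ.- 1ℤ) (cong +_ (ℕP.+-comm 1 i))) (shift (+ i) (+ m))
  where
  shift : ∀ i m → i ℤ.+ 1ℤ ℤ.- m ℤ.- 1ℤ ≡ i ℤ.- m ℤ.- 1ℤ ℤ.+ 1ℤ
  shift = solve-∀

start-suc-row : ∀ i → ℤ.- + suc i ℤ.< ℤ.- + i
start-suc-row i = ℤP.neg-mono-< (+<+ (ℕP.n<1+n i))

module _ {m} {T₁ T₂ : Tiling m} (no-interaction : NoInteractions m T₁ T₂) {i : ℕ} where

  same-index-below : (P : Path m T₁ i) (Q : Path m T₂ i) →
                     ∀ {t h₁ h₂} → OnPath t h₁ P → OnPath t h₂ Q → h₁ ℚ.≤ h₂
  same-index-below P Q on₁ on₂ = subst (ℚ._≤ _) (ℚP.+-identityʳ _)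
    (heights-ordered 0ℤ ordered (onPath⇒stepAt [] P on₁) (onPath⇒stepAt [] Q on₂))
    where
    ordered : ∀ {c k₁ k₂} → Through T₁ (start m i) (end m i) (c , k₁) →
              Through T₂ (start m i) (end m i) (c , k₂) → k₁ ℤ.+ 0ℤ ℤ.≤ k₂
    ordered (_ , rest₁) (_ , rest₂) = subst (ℤ._≤ _) (sym (ℤP.+-identityʳ _))
      (ℤP.≮⇒≥ (λ k₂<k₁ → ℤP.<-irrefl refl (stays-below no-interaction rest₁ rest₂ k₂<k₁)))

  next-index-strictly-below : (P : Path m T₁ i) (R : Path m T₂ (suc i)) →
                              ∀ {t h₁ h₃} → OnPath t h₁ P → OnPath t h₃ R → h₃ ℚ.< h₁
  next-index-strictly-below P R {h₃ = h₃} on₁ on₃ =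
    ℚP.<-≤-trans (subst (ℚ._< h₃ + 1ℚ) (ℚP.+-identityʳ h₃) (ℚP.+-monoʳ-< h₃ (ℚP.positive⁻¹ 1ℚ)))
      (heights-ordered 1ℤ ordered (onPath⇒stepAt [] R on₃) (onPath⇒stepAt [] P on₁))
    where
    ordered : ∀ {c k₃ k₁} → Through T₂ (start m (suc i)) (end m (suc i)) (c , k₃) →
              Through T₁ (start m i) (end m i) (c , k₁) → k₃ ℤ.+ 1ℤ ℤ.≤ k₁
    ordered (start₃ , _) (start₁ , _) = <⇒+1≤
      (shifted-start-stays-below no-interaction (first-step-never-descends {i = i} refl)
        start₁ start₃ (start-suc-column m i) (start-suc-row i))

mainTheorem4 : (m : ℕ) → 1 ≤ m → (T₁ T₂ : Tiling m) → NoInteractions m T₁ T₂ →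
    ((i : ℕ) → 1 ≤ i → i ≤ m →
       (P : Path m T₁ i) (Q : Path m T₂ i) →
       (t h₁ h₂ : ℚ) → OnPath t h₁ P → OnPath t h₂ Q → h₁ ℚ.≤ h₂)
    ×
    ((i : ℕ) → 1 ≤ i → i < m →
       (P : Path m T₁ i) (R : Path m T₂ (suc i)) →
       (t h₁ h₃ : ℚ) → OnPath t h₁ P → OnPath t h₃ R → h₃ ℚ.< h₁)
mainTheorem4 m _ T₁ T₂ no-interaction =
    (λ i _ _ P Q _ _ _ → same-index-below no-interaction P Q)
  , (λ i _ _ P R _ _ _ → next-index-strictly-below no-interaction P R)
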